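{- Let $\Phi$ be an irreducible crystallographic root system and $k$ a positive integer. If $\mathcal{I}=(I_1,\ldots,I_k)$ is a geometric chain of $k$ ideals in the root poset of $\Phi$, then $\underline{\mathcal{I}}$ is a positive geometric chain of $k+1$ ideals, and the bounded dominant region $\underline{R}=\theta^{ -1}(\underline{\mathcal{I}})$ of the $(k+1)$-Catalan arrangement of $\Phi$ is contained in the region $R=\theta^{ -1}(\mathcal{I})$ of the $k$-Catalan arrangement.
   Context: $\Phi$ lies in a Euclidean space $V$ with inner product $\langle\cdot,\cdot\rangle$, simple system $S$, positive system $\Phi^+$. $H_\alpha^r=\{x\mid\langle x,\alpha\rangle=r\}$. The $k$-Catalan arrangement consists of $H_\alpha^r$, $\alpha\in\Phi$, $r\in\{0,\ldots,k\}$; regions are components of the complement; dominant means $\langle x,\alpha\rangle>0$ for all $x\in R$, $\alpha\in\Phi^+$. Root poset: $\alpha\le\beta$ iff $\beta-\alpha\in\mathbb{N}$-span of $S$; ideals are down-closed subsets, order filters up-closed subsets of $\Phi^+$. An ascending chain of ideals $I_1\subseteq\cdots\subseteq I_k$ with complementary order filters $J_i=\Phi^+\setminus I_i$ is geometric if $(I_i+I_j)\cap\Phi^+\subseteq I_{i+j}$ for all $i,j\ge0$ with $i+j\le k$, and $(J_i+J_j)\cap\Phi^+\subseteq J_{i+j}$ for all $i,j\in\{0,\ldots,k\}$, where $I_0=\varnothing$, $J_0=\Phi^+$, $J_i=J_k$ for $i>k$. It is positive if $S\subseteq I_k$. For a dominant region $R$ of the $k$-Catalan arrangement, $\theta(R)=(I_1,\ldots,I_k)$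 with $I_i=\{\alpha\in\Phi^+\mid \langle x,\alpha\rangle<i\ \forall x\in R\}$; it is known that $\theta$ is a bijection from dominant regions of the $k$-Catalan arrangement onto geometric chains of $k$ ideals, restricting to a bijection from bounded dominant regions onto positive geometric chains. For $\mathcal{I}=(I_1,\ldots,I_k)$ define $\underline{\mathcal{I}}=(\underline{I}_1,\ldots,\underline{I}_{k+1})$ by $\underline{I}_i=I_i$ for $i\in[k]$ and $\underline{I}_{k+1}=\bigcup_{i+j=k+1}((I_i+I_j)\cap\Phi^+)\cup I_k\cup S$.
   Formalization: The Euclidean space V is taken as ℚ^n with a rational-valued inner product, so the roots and the points of the regions of the Catalan arrangements have rational coordinates. -}

module Defs where

open import Level using (0ℓ)
open import Data.Nat as ℕ using (ℕ; zero; suc; _⊓_)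
open import Data.Integer as ℤ using (ℤ; +_)
open import Data.Rational as ℚ using (ℚ; 0ℚ; 1ℚ; _/_)
open import Data.Vec using (Vec; []; _∷_; zipWith; map; replicate)
open import Data.Vec.Membership.Propositional using (_∈_)
open import Data.List as List using (List)
import Data.List.Membership.Propositional as LM
open import Data.Product using (Σ; ∃; _×_; _,_)
open import Data.Sum using (_⊎_)
open import Data.Bool using (Bool; true; false)
open import Relation.Nullary using (¬_)
open import Relation.Binary.PropositionalEquality using (_≡_; _≢_)
open import Relation.Unary using (Pred)
open import Data.Vec.Relation.Unary.All using (All)

-- Vectors in V = ℚ^n (rationals instead of reals)

V : ℕ → Set
V n = Vec ℚ n

infixl 6 _+ᵥ_ _-ᵥ_
infixl 7 _·ᵥ_

_+ᵥ_ : ∀ {n} → V n → V n → V n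
_+ᵥ_ = zipWith ℚ._+_

_·ᵥ_ : ∀ {n} → ℚ → V n → V n
c ·ᵥ v = map (c ℚ.*_) v

-ᵥ_ : ∀ {n} → V n → V n
-ᵥ v = map ℚ.-_ v

_-ᵥ_ : ∀ {n} → V n → V n → V n
u -ᵥ v = u +ᵥ (-ᵥ v)

0ᵥ : ∀ {n} → V n
0ᵥ = replicate _ 0ℚ

lincomb : ∀ {n r} → Vec ℚ r → Vec (V n) r → V n
lincomb []       []       = 0ᵥ
lincomb (c ∷ cs) (v ∷ vs) = c ·ᵥ v +ᵥ lincomb cs vs

ℕtoℚ : ℕ → ℚ
ℕtoℚ m = + m / 1

ℤtoℚ : ℤ → ℚ
ℤtoℚ z = z / 1

record Euclidean (n : ℕ) : Set where
  field
    ⟨_,_⟩    : V n → V n → ℚ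
    sym      : ∀ x y → ⟨ x , y ⟩ ≡ ⟨ y , x ⟩
    add-l    : ∀ x y z → ⟨ x +ᵥ y , z ⟩ ≡ ⟨ x , z ⟩ ℚ.+ ⟨ y , z ⟩
    scale-l  : ∀ c x y → ⟨ c ·ᵥ x , y ⟩ ≡ c ℚ.* ⟨ x , y ⟩
    pos-def  : ∀ x → x ≢ 0ᵥ → 0ℚ ℚ.< ⟨ x , x ⟩

record RootSystem {n : ℕ} (E : Euclidean n) : Set where
  open Euclidean E
  field
    roots    : List (V n)
    nonzero  : ∀ {α} → α LM.∈ roots → α ≢ 0ᵥ
    reduced  : ∀ {α} c → α LM.∈ roots → (c ·ᵥ α) LM.∈ roots → (c ≡ 1ℚ) ⊎ (c ≡ ℚ.- 1ℚ)
    -- closure under reflections s_α(β) = β - (2⟨β,α⟩/⟨α,α⟩) α, and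
    -- crystallographic: 2⟨β,α⟩/⟨α,α⟩ ∈ ℤ
    refl-cryst : ∀ {α β} → α LM.∈ roots → β LM.∈ roots →
                 Σ ℤ λ m → ((ℕtoℚ 2 ℚ.* ⟨ β , α ⟩ ≡ ℤtoℚ m ℚ.* ⟨ α , α ⟩)
                           × ((β -ᵥ ℤtoℚ m ·ᵥ α) LM.∈ roots))

module _ {n : ℕ} {E : Euclidean n} where
  open Euclidean E

  Irreducible : RootSystem E → Set
  Irreducible Φ =
    (P : V n → Bool) →
    (∀ {α β} → α LM.∈ roots → β LM.∈ roots → P α ≡ true → P β ≡ false → ⟨ α , β ⟩ ≡ 0ℚ) →
    (∀ {α} → α LM.∈ roots → P α ≡ true) ⊎ (∀ {α} → α LM.∈ roots → P α ≡ false)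
    where open RootSystem Φ

  record SimpleSystem (Φ : RootSystem E) : Set where
    open RootSystem Φ
    field
      simple   : Vec (V n) n
      in-roots : ∀ {s} → s ∈ simple → s LM.∈ roots
      lin-ind  : ∀ (c : Vec ℚ n) → lincomb c simple ≡ 0ᵥ → c ≡ replicate n 0ℚ
      sign     : ∀ {α} → α LM.∈ roots → Σ (Vec ℚ n) λ c →
                   (All (0ℚ ℚ.≤_) c × α ≡ lincomb c simple) ⊎
                   (All (ℚ._≤ 0ℚ) c × α ≡ lincomb c simple)

module RootPoset {n : ℕ} {E : Euclidean n} (Φ : RootSystem E) (S : SimpleSystem Φ) where
  open Euclidean E
  open RootSystem Φ
  open SimpleSystem S

  Subset : Set₁
  Subset = Pred (V n) 0ℓ

  Φ⁺ : Subset
  Φ⁺ α = α LM.∈ roots × Σ (Vec ℚ n) λ c → All (0ℚ ℚ.≤_) c × α ≡ lincomb c simple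

  _≤Φ_ : V n → V n → Set
  α ≤Φ β = Σ (Vec ℕ n) λ c → β ≡ α +ᵥ lincomb (map ℕtoℚ c) simple

  IsIdeal : Subset → Set
  IsIdeal I = (∀ {α} → I α → Φ⁺ α) ×
              (∀ {α β} → Φ⁺ α → I β → α ≤Φ β → I α)

  -- A chain of k ideals I₁ ⊆ ⋯ ⊆ Iₖ is represented by I : ℕ → Subset,
  -- of which only the indices 1,…,k are used.
  -- Extended convention: I₀ = ∅, Iᵢ = Iₖ for i > k.
  Iₑ : ℕ → (ℕ → Subset) → ℕ → Subset
  Iₑ k I i α = 1 ℕ.≤ i × I (i ⊓ k) α

  Jₑ : ℕ → (ℕ → Subset) → ℕ → Subset
  Jₑ k I i α = Φ⁺ α × ¬ Iₑ k I i α

  IsChain : ℕ → (ℕ → Subset) → Set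
  IsChain k I = (∀ i → 1 ℕ.≤ i → i ℕ.≤ k → IsIdeal (I i)) ×
                (∀ i j → 1 ℕ.≤ i → i ℕ.≤ j → j ℕ.≤ k → ∀ {α} → I i α → I j α)

  IsGeometric : ℕ → (ℕ → Subset) → Set
  IsGeometric k I =
    IsChain k I ×
    (∀ i j → i ℕ.+ j ℕ.≤ k → ∀ {α β} → Iₑ k I i α → Iₑ k I j β →
       Φ⁺ (α +ᵥ β) → Iₑ k I (i ℕ.+ j) (α +ᵥ β)) ×
    (∀ i j → i ℕ.≤ k → j ℕ.≤ k → ∀ {α β} → Jₑ k I i α → Jₑ k I j β →
       Φ⁺ (α +ᵥ β) → Jₑ k I (i ℕ.+ j) (α +ᵥ β))

  IsPositive : ℕ → (ℕ → Subset) → Set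
  IsPositive k I = ∀ {s} → s ∈ simple → I k s

  top : ℕ → (ℕ → Subset) → Subset
  top k I α =
    (Σ ℕ λ i → Σ ℕ λ j → 1 ℕ.≤ i × 1 ℕ.≤ j × i ℕ.+ j ≡ suc k ×
       Σ (V n) λ β → Σ (V n) λ γ → I i β × I j γ × α ≡ β +ᵥ γ × Φ⁺ α)
    ⊎ I k α ⊎ α ∈ simple

  underline : ℕ → (ℕ → Subset) → ℕ → Subset
  underline k I i α = (i ℕ.≤ k × I i α) ⊎ (suc k ℕ.≤ i × top k I α)

  -- θ⁻¹(I): the dominant region of the k-Catalan arrangement whose image
  -- under θ is I, as a set of points: for each α ∈ Φ⁺, ⟨x,α⟩ > 0 and for
  -- i ∈ [k], ⟨x,α⟩ < i if α ∈ Iᵢ and ⟨x,α⟩ > i otherwise.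
  θ⁻¹ : ℕ → (ℕ → Subset) → Pred (V n) 0ℓ
  θ⁻¹ k I x = ∀ α → Φ⁺ α →
    0ℚ ℚ.< ⟨ x , α ⟩ ×
    (∀ i → 1 ℕ.≤ i → i ℕ.≤ k →
       (I i α → ⟨ x , α ⟩ ℚ.< ℕtoℚ i) × (¬ I i α → ℕtoℚ i ℚ.< ⟨ x , α ⟩))

-- The first k ideals of I̲ are those of I, so everything is about the new top ideal
-- I̲ₖ₊₁ = ⋃_{i+j=k+1} (Iᵢ + Iⱼ) ∩ Φ⁺ ∪ Iₖ ∪ S. One root-system fact drives the argument: if x, y are roots
-- with ⟨x, y⟩ > 0 then x = y or x - y is a root (a Cartan integer equal to 1, or else ⟨x - y, x - y⟩ ≤ 0).
-- When a root α + β equals y + z, one of ⟨α,y⟩, ⟨α,z⟩, ⟨β,y⟩, ⟨β,z⟩ is positive, and comparing that pair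
-- moves a positive root from one summand to the other.
--   * I̲ₖ₊₁ is an order ideal: it is closed under removing a simple root (ρ + s ∈ I̲ₖ₊₁ ⇒ ρ ∈ I̲ₖ₊₁), and any
--     γ ≤ δ in Φ⁺ is reached from δ by such steps inside Φ⁺.
--   * The I-condition of I̲ is that of I, except when the weights add up to k + 1, where I̲ₖ₊₁ is built to absorb it.
--   * The J-condition of I̲: if α ∉ I̲ᵢ, β ∉ I̲ⱼ and α + β = y + z ∈ I̲ₖ₊₁, moving the positive difference of an
--     acute pair produces a sum that violates the J-condition of I.
-- Positivity holds since S ⊆ I̲ₖ₊₁, and R̲ ⊆ R since I̲ᵢ = Iᵢ for i ≤ k.

module Submission where

open import Defs
open import Data.Nat using (ℕ; suc; _≤_)
open import Data.Product using (_×_)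

open import Level using (0ℓ)
open import Algebra.Bundles using (AbelianGroup)
open import Algebra.Structures using (IsAbelianGroup)
import Algebra.Properties.AbelianGroup as AbelianGroupProperties
import Algebra.Properties.CommutativeSemigroup as CommutativeSemigroupProperties
open import Data.Nat as ℕ using (zero; _⊓_; z≤n; s≤s; _∸_)
import Data.Nat.Properties as ℕP
open import Data.Integer as ℤ using (ℤ; +_; -[1+_])
import Data.Integer.Properties as ℤP
open import Data.Rational as ℚ using (ℚ; 0ℚ; 1ℚ)
import Data.Rational.Properties as ℚP
import Data.Rational.Solver as ℚSolver
import Data.Rational.Unnormalised as ℚᵘ
import Data.Rational.Unnormalised.Properties as ℚᵘP
open import Data.Vec as Vec using (Vec; []; _∷_)
import Data.Vec.Properties as VecP
open import Data.Vec.Membership.Propositional using (_∈_)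
open import Data.Vec.Relation.Unary.Any using (here; there)
open import Data.Vec.Relation.Unary.All as All using (All; []; _∷_; universal)
open import Data.Vec.Relation.Unary.All.Properties using (map⁺)
import Data.List.Membership.Propositional as LM
open import Data.Product using (Σ; _,_; proj₁; proj₂)
open import Data.Sum using (_⊎_; inj₁; inj₂)
open import Data.Empty using (⊥; ⊥-elim)
open import Relation.Nullary using (¬_; yes; no)
open import Relation.Binary.PropositionalEquality
open import Relation.Binary.PropositionalEquality.Algebra using (isMagma)

open ℚSolver.+-*-Solver using (solve; _:+_; _:*_; :-_; _:=_; con)

ℕtoℚ-+ : ∀ m n → ℕtoℚ (m ℕ.+ n) ≡ ℕtoℚ m ℚ.+ ℕtoℚ n
ℕtoℚ-+ m n = ℚP.toℚᵘ-injective (begin-equality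
  ℚ.toℚᵘ (ℕtoℚ (m ℕ.+ n))                  ≃⟨ ℚP.toℚᵘ-fromℚᵘ _ ⟩
  ℚᵘ.mkℚᵘ (+ (m ℕ.+ n)) 0                   ≃⟨ ℚᵘ.*≡* (lemma (+ m) (+ n)) ⟩
  ℚᵘ.mkℚᵘ (+ m) 0 ℚᵘ.+ ℚᵘ.mkℚᵘ (+ n) 0      ≃⟨ ℚᵘP.+-cong (ℚP.toℚᵘ-fromℚᵘ (ℚᵘ.mkℚᵘ (+ m) 0))
                                                             (ℚP.toℚᵘ-fromℚᵘ (ℚᵘ.mkℚᵘ (+ n) 0)) ⟨
  ℚ.toℚᵘ (ℕtoℚ m) ℚᵘ.+ ℚ.toℚᵘ (ℕtoℚ n)      ≃⟨ ℚP.toℚᵘ-homo-+ (ℕtoℚ m) (ℕtoℚ n) ⟨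
  ℚ.toℚᵘ (ℕtoℚ m ℚ.+ ℕtoℚ n)                ∎)
  where
  open ℚᵘP.≤-Reasoning
  lemma : ∀ x y → (x ℤ.+ y) ℤ.* + 1 ≡ (x ℤ.* + 1 ℤ.+ y ℤ.* + 1) ℤ.* + 1
  lemma x y = trans (ℤP.*-identityʳ _) (sym (trans (ℤP.*-identityʳ _)
    (cong₂ ℤ._+_ (ℤP.*-identityʳ x) (ℤP.*-identityʳ y))))

ℕtoℚ-nonNeg : ∀ m → 0ℚ ℚ.≤ ℕtoℚ m
ℕtoℚ-nonNeg m = ℚP.nonNegative⁻¹ _ {{ℚP.normalize-nonNeg m 1}}

ℕtoℚ-pos : ∀ m → 0ℚ ℚ.< ℕtoℚ (suc m)
ℕtoℚ-pos m = ℚP.positive⁻¹ _ {{ℚP.normalize-pos (suc m) 1}}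

ℤtoℚ-cases : (m : ℤ) → m ≡ + 1 ⊎ ℤtoℚ m ℚ.≤ 0ℚ ⊎ ℕtoℚ 2 ℚ.≤ ℤtoℚ m
ℤtoℚ-cases (+ zero)          = inj₂ (inj₁ ℚP.≤-refl)
ℤtoℚ-cases (+ suc zero)      = inj₁ refl
ℤtoℚ-cases (+ suc (suc j))   = inj₂ (inj₂ (begin
  ℕtoℚ 2                 ≡⟨ ℚP.+-identityʳ (ℕtoℚ 2) ⟨
  ℕtoℚ 2 ℚ.+ 0ℚ          ≤⟨ ℚP.+-monoʳ-≤ (ℕtoℚ 2) (ℕtoℚ-nonNeg j) ⟩
  ℕtoℚ 2 ℚ.+ ℕtoℚ j      ≡⟨ ℕtoℚ-+ 2 j ⟨
  ℕtoℚ (2 ℕ.+ j)         ∎))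
  where open ℚP.≤-Reasoning
ℤtoℚ-cases -[1+ j ]          = inj₂ (inj₁ (ℚP.neg-antimono-≤ (ℕtoℚ-nonNeg (suc j))))

pos-+⇒pos⊎pos : ∀ p q → 0ℚ ℚ.< p ℚ.+ q → 0ℚ ℚ.< p ⊎ 0ℚ ℚ.< q
pos-+⇒pos⊎pos p q 0<p+q with 0ℚ ℚ.<? p | 0ℚ ℚ.<? q
... | yes 0<p | _       = inj₁ 0<p
... | no _    | yes 0<q = inj₂ 0<q
... | no p≯0  | no q≯0  = ⊥-elim (ℚP.<-irrefl refl
  (ℚP.<-≤-trans 0<p+q (ℚP.+-mono-≤ (ℚP.≮⇒≥ p≯0) (ℚP.≮⇒≥ q≯0))))

nonNeg-+≡0⇒≡0 : ∀ {p q} → 0ℚ ℚ.≤ p → 0ℚ ℚ.≤ q → p ℚ.+ q ≡ 0ℚ → p ≡ 0ℚ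
nonNeg-+≡0⇒≡0 {p} {q} 0≤p 0≤q p+q≡0 = ℚP.≤-antisym
  (subst₂ ℚ._≤_ (ℚP.+-identityʳ p) p+q≡0 (ℚP.+-monoʳ-≤ p 0≤q)) 0≤p

+-nonPos-pos⇒neg : ∀ {p q} → p ℚ.+ q ℚ.≤ 0ℚ → 0ℚ ℚ.< q → p ℚ.< 0ℚ
+-nonPos-pos⇒neg {p} {q} p+q≤0 0<q = begin-strict
  p              ≡⟨ ℚP.+-identityʳ p ⟨
  p ℚ.+ 0ℚ       <⟨ ℚP.+-monoʳ-< p 0<q ⟩
  p ℚ.+ q        ≤⟨ p+q≤0 ⟩
  0ℚ             ∎
  where open ℚP.≤-Reasoning

*-cancelʳ-≡-pos : ∀ {p q} r → 0ℚ ℚ.< r → p ℚ.* r ≡ q ℚ.* r → p ≡ q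
*-cancelʳ-≡-pos r 0<r pr≡qr = ℚP.≤-antisym
  (ℚP.*-cancelʳ-≤-pos r {{ℚ.positive 0<r}} (ℚP.≤-reflexive pr≡qr))
  (ℚP.*-cancelʳ-≤-pos r {{ℚ.positive 0<r}} (ℚP.≤-reflexive (sym pr≡qr)))

≤⇒≤⊓+⊓ : ∀ {a i j k} → a ≤ k → a ≤ i ℕ.+ j → a ≤ i ⊓ k ℕ.+ j ⊓ k
≤⇒≤⊓+⊓ {a} {i} {j} {k} a≤k a≤i+j with ℕP.≤-total i k | ℕP.≤-total j k
... | inj₁ i≤k | inj₁ j≤k rewrite ℕP.m≤n⇒m⊓n≡m i≤k | ℕP.m≤n⇒m⊓n≡m j≤k = a≤i+j
... | inj₁ _   | inj₂ k≤j rewrite ℕP.m≥n⇒m⊓n≡n k≤j = ℕP.≤-trans a≤k (ℕP.m≤n+m k (i ⊓ k))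
... | inj₂ k≤i | _        rewrite ℕP.m≥n⇒m⊓n≡n k≤i = ℕP.≤-trans a≤k (ℕP.m≤m+n k (j ⊓ k))

+≤1+⇒≤ : ∀ {a b k} → a ℕ.+ b ≤ suc k → 1 ≤ a → b ≤ k
+≤1+⇒≤ {a} {b} a+b≤1+k 1≤a = ℕP.≤-pred (ℕP.≤-trans (ℕP.+-monoˡ-≤ b 1≤a) a+b≤1+k)

x+y≰m : ∀ {m x y} → m ≤ x → 1 ≤ y → ¬ (x ℕ.+ y ≤ m)
x+y≰m {m} {x} {y} m≤x 1≤y x+y≤m = ℕP.<⇒≱ (subst (_≤ x ℕ.+ y) (ℕP.+-comm m 1) (ℕP.+-mono-≤ m≤x 1≤y)) x+y≤m

+ᵥ-isAbelianGroup : ∀ {n} → IsAbelianGroup _≡_ (_+ᵥ_ {n}) 0ᵥ (λ x → -ᵥ x)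
+ᵥ-isAbelianGroup = record
  { isGroup = record
    { isMonoid = record
      { isSemigroup = record { isMagma = isMagma _+ᵥ_ ; assoc = VecP.zipWith-assoc ℚP.+-assoc }
      ; identity    = VecP.zipWith-identityˡ ℚP.+-identityˡ , VecP.zipWith-identityʳ ℚP.+-identityʳ
      }
    ; inverse = VecP.zipWith-inverseˡ ℚP.+-inverseˡ , VecP.zipWith-inverseʳ ℚP.+-inverseʳ
    ; ⁻¹-cong = cong (λ x → -ᵥ x)
    }
  ; comm = VecP.zipWith-comm ℚP.+-comm
  }

+ᵥ-abelianGroup : ℕ → AbelianGroup 0ℓ 0ℓ
+ᵥ-abelianGroup n = record { isAbelianGroup = +ᵥ-isAbelianGroup {n} }

module Vᴳ {n : ℕ} where
  open AbelianGroup (+ᵥ-abelianGroup n) public using (assoc; comm; identityˡ; identityʳ; inverseʳ)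
  open AbelianGroupProperties (+ᵥ-abelianGroup n) public
  open CommutativeSemigroupProperties (AbelianGroup.commutativeSemigroup (+ᵥ-abelianGroup n)) public
    using (interchange; x∙yz≈y∙xz)

+ᵥ-[-ᵥ] : ∀ {n} (x y : V n) → y +ᵥ (x -ᵥ y) ≡ x
+ᵥ-[-ᵥ] x y = trans (sym (Vᴳ.assoc y x (-ᵥ y))) (Vᴳ.xyx⁻¹≈y y x)

+ᵥ-exchange : ∀ {n} {x y τ v z : V n} → x ≡ y +ᵥ τ → x +ᵥ v ≡ y +ᵥ z → z ≡ v +ᵥ τ
+ᵥ-exchange {x = x} {y} {τ} {v} {z} refl x+v≡y+z = Vᴳ.∙-cancelˡ y z (v +ᵥ τ) (begin
  y +ᵥ z            ≡⟨ x+v≡y+z ⟨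
  (y +ᵥ τ) +ᵥ v     ≡⟨ Vᴳ.assoc y τ v ⟩
  y +ᵥ (τ +ᵥ v)     ≡⟨ cong (y +ᵥ_) (Vᴳ.comm τ v) ⟩
  y +ᵥ (v +ᵥ τ)     ∎)
  where open ≡-Reasoning

·ᵥ-identityˡ : ∀ {n} (x : V n) → 1ℚ ·ᵥ x ≡ x
·ᵥ-identityˡ x = trans (VecP.map-cong ℚP.*-identityˡ x) (VecP.map-id x)

·ᵥ-zeroˡ : ∀ {n} (x : V n) → 0ℚ ·ᵥ x ≡ 0ᵥ
·ᵥ-zeroˡ x = trans (VecP.map-cong ℚP.*-zeroˡ x) (VecP.map-const x 0ℚ)

·ᵥ-distribʳ : ∀ {n} c d (x : V n) → (c ℚ.+ d) ·ᵥ x ≡ c ·ᵥ x +ᵥ d ·ᵥ x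
·ᵥ-distribʳ c d []      = refl
·ᵥ-distribʳ c d (a ∷ x) = cong₂ _∷_ (ℚP.*-distribʳ-+ a c d) (·ᵥ-distribʳ c d x)

·ᵥ-neg : ∀ {n} c (x : V n) → (ℚ.- c) ·ᵥ x ≡ -ᵥ (c ·ᵥ x)
·ᵥ-neg c x = trans (VecP.map-cong (λ a → sym (ℚP.neg-distribˡ-* c a)) x) (VecP.map-∘ ℚ.-_ (c ℚ.*_) x)

-ᵥ≡-1·ᵥ : ∀ {n} (x : V n) → -ᵥ x ≡ (ℚ.- 1ℚ) ·ᵥ x
-ᵥ≡-1·ᵥ x = trans (cong -ᵥ_ (sym (·ᵥ-identityˡ x))) (sym (·ᵥ-neg 1ℚ x))

x-2x≡-x : ∀ {n} (x : V n) → x -ᵥ ℕtoℚ 2 ·ᵥ x ≡ -ᵥ x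
x-2x≡-x [] = refl
x-2x≡-x (a ∷ x) = cong₂ _∷_ (solve 1 (λ a → a :+ :- ((con 1ℚ :+ con 1ℚ) :* a) := :- a) refl a) (x-2x≡-x x)

suc·ᵥ : ∀ {n} m (x : V n) → ℕtoℚ (suc m) ·ᵥ x ≡ x +ᵥ ℕtoℚ m ·ᵥ x
suc·ᵥ m x = begin
  ℕtoℚ (1 ℕ.+ m) ·ᵥ x              ≡⟨ cong (_·ᵥ x) (ℕtoℚ-+ 1 m) ⟩
  (1ℚ ℚ.+ ℕtoℚ m) ·ᵥ x             ≡⟨ ·ᵥ-distribʳ 1ℚ (ℕtoℚ m) x ⟩
  1ℚ ·ᵥ x +ᵥ ℕtoℚ m ·ᵥ x           ≡⟨ cong (_+ᵥ ℕtoℚ m ·ᵥ x) (·ᵥ-identityˡ x) ⟩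
  x +ᵥ ℕtoℚ m ·ᵥ x                 ∎
  where open ≡-Reasoning

lincomb-zero : ∀ {n r} (S : Vec (V n) r) → lincomb 0ᵥ S ≡ 0ᵥ
lincomb-zero []      = refl
lincomb-zero (s ∷ S) = trans (cong₂ _+ᵥ_ (·ᵥ-zeroˡ s) (lincomb-zero S)) (Vᴳ.identityˡ 0ᵥ)

lincomb-+ : ∀ {n r} (c d : V r) (S : Vec (V n) r) → lincomb (c +ᵥ d) S ≡ lincomb c S +ᵥ lincomb d S
lincomb-+ []       []       []      = sym (Vᴳ.identityˡ 0ᵥ)
lincomb-+ (c ∷ cs) (d ∷ ds) (s ∷ S) = begin
  (c ℚ.+ d) ·ᵥ s +ᵥ lincomb (cs +ᵥ ds) S                  ≡⟨ cong₂ _+ᵥ_ (·ᵥ-distribʳ c d s) (lincomb-+ cs ds S) ⟩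
  (c ·ᵥ s +ᵥ d ·ᵥ s) +ᵥ (lincomb cs S +ᵥ lincomb ds S)    ≡⟨ Vᴳ.interchange _ _ _ _ ⟩
  (c ·ᵥ s +ᵥ lincomb cs S) +ᵥ (d ·ᵥ s +ᵥ lincomb ds S)    ∎
  where open ≡-Reasoning

lincomb-neg : ∀ {n r} (c : V r) (S : Vec (V n) r) → lincomb (-ᵥ c) S ≡ -ᵥ lincomb c S
lincomb-neg []       []      = sym Vᴳ.ε⁻¹≈ε
lincomb-neg (c ∷ cs) (s ∷ S) = trans (cong₂ _+ᵥ_ (·ᵥ-neg c s) (lincomb-neg cs S)) (Vᴳ.⁻¹-∙-comm _ _)

lincomb-injective : ∀ {n r} (S : Vec (V n) r) → (∀ c → lincomb c S ≡ 0ᵥ → c ≡ 0ᵥ) →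
                    ∀ {c d} → lincomb c S ≡ lincomb d S → c ≡ d
lincomb-injective S independent {c} {d} same = Vᴳ.x∙y⁻¹≈ε⇒x≈y c d (independent (c -ᵥ d) (begin
  lincomb (c -ᵥ d) S                  ≡⟨ lincomb-+ c (-ᵥ d) S ⟩
  lincomb c S +ᵥ lincomb (-ᵥ d) S     ≡⟨ cong₂ _+ᵥ_ same (lincomb-neg d S) ⟩
  lincomb d S -ᵥ lincomb d S          ≡⟨ Vᴳ.inverseʳ (lincomb d S) ⟩
  0ᵥ                                  ∎))
  where open ≡-Reasoning

unit : ∀ {A : Set} {r} {s : A} {S : Vec A r} → s ∈ S → Vec ℕ r
unit {r = suc r} (here _)  = 1 ∷ Vec.replicate r 0
unit             (there p) = 0 ∷ unit p

lincomb-unit : ∀ {n r} {s : V n} {S : Vec (V n) r} (p : s ∈ S) → lincomb (Vec.map ℕtoℚ (unit p)) S ≡ s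
lincomb-unit {r = suc r} {S = s ∷ S} (here refl) = begin
  1ℚ ·ᵥ s +ᵥ lincomb (Vec.map ℕtoℚ (Vec.replicate r 0)) S    ≡⟨ cong (λ c → 1ℚ ·ᵥ s +ᵥ lincomb c S)
                                                                     (VecP.map-replicate ℕtoℚ 0 r) ⟩
  1ℚ ·ᵥ s +ᵥ lincomb 0ᵥ S                                    ≡⟨ cong₂ _+ᵥ_ (·ᵥ-identityˡ s) (lincomb-zero S) ⟩
  s +ᵥ 0ᵥ                                                    ≡⟨ Vᴳ.identityʳ s ⟩
  s                                                          ∎
  where open ≡-Reasoning
lincomb-unit {S = s′ ∷ S} (there p) = trans (cong₂ _+ᵥ_ (·ᵥ-zeroˡ s′) (lincomb-unit p)) (Vᴳ.identityˡ _)

ℕtoℚ-nonNegᵥ : ∀ {r} (c : Vec ℕ r) → All (0ℚ ℚ.≤_) (Vec.map ℕtoℚ c)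
ℕtoℚ-nonNegᵥ c = map⁺ (universal ℕtoℚ-nonNeg c)

nonNeg-+≡0ᵥ⇒≡0ᵥ : ∀ {r} {g h : V r} → All (0ℚ ℚ.≤_) g → All (0ℚ ℚ.≤_) h → g +ᵥ h ≡ 0ᵥ → g ≡ 0ᵥ
nonNeg-+≡0ᵥ⇒≡0ᵥ []         []         _   = refl
nonNeg-+≡0ᵥ⇒≡0ᵥ (0≤g ∷ gs) (0≤h ∷ hs) g+h≡0 = cong₂ _∷_
  (nonNeg-+≡0⇒≡0 0≤g 0≤h (VecP.∷-injectiveˡ g+h≡0)) (nonNeg-+≡0ᵥ⇒≡0ᵥ gs hs (VecP.∷-injectiveʳ g+h≡0))

nonNeg-summand-unit : ∀ {n r} {s : V n} {S : Vec (V n) r} (p : s ∈ S) {g h : V r} →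
                      All (0ℚ ℚ.≤_) g → All (0ℚ ℚ.≤_) h → g +ᵥ h ≡ Vec.map ℕtoℚ (unit p) →
                      Σ ℚ λ t → 0ℚ ℚ.≤ t × lincomb g S ≡ t ·ᵥ s
nonNeg-summand-unit {r = suc r} {S = s ∷ S} (here refl) {g ∷ gs} (0≤g ∷ gs≥0) (_ ∷ hs≥0) g+h≡e =
  g , 0≤g , (begin
    g ·ᵥ s +ᵥ lincomb gs S     ≡⟨ cong (λ c → g ·ᵥ s +ᵥ lincomb c S) gs≡0 ⟩
    g ·ᵥ s +ᵥ lincomb 0ᵥ S     ≡⟨ cong (g ·ᵥ s +ᵥ_) (lincomb-zero S) ⟩
    g ·ᵥ s +ᵥ 0ᵥ               ≡⟨ Vᴳ.identityʳ _ ⟩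
    g ·ᵥ s                     ∎)
  where
  open ≡-Reasoning
  gs≡0 = nonNeg-+≡0ᵥ⇒≡0ᵥ gs≥0 hs≥0 (trans (VecP.∷-injectiveʳ g+h≡e) (VecP.map-replicate ℕtoℚ 0 r))
nonNeg-summand-unit {S = s′ ∷ S} (there p) {g ∷ gs} (0≤g ∷ gs≥0) (0≤h ∷ hs≥0) g+h≡e
  with nonNeg-summand-unit p gs≥0 hs≥0 (VecP.∷-injectiveʳ g+h≡e)
... | t , 0≤t , gs≡ts = t , 0≤t , (begin
    g ·ᵥ s′ +ᵥ lincomb gs S    ≡⟨ cong₂ _+ᵥ_ (cong (_·ᵥ s′) g≡0) gs≡ts ⟩
    0ℚ ·ᵥ s′ +ᵥ t ·ᵥ _         ≡⟨ cong (_+ᵥ t ·ᵥ _) (·ᵥ-zeroˡ s′) ⟩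
    0ᵥ +ᵥ t ·ᵥ _               ≡⟨ Vᴳ.identityˡ _ ⟩
    t ·ᵥ _                     ∎)
  where
  open ≡-Reasoning
  g≡0 = nonNeg-+≡0⇒≡0 0≤g 0≤h (VecP.∷-injectiveˡ g+h≡e)

module InnerProduct {n : ℕ} (E : Euclidean n) where
  open Euclidean E renaming (sym to ⟨⟩-comm; add-l to ⟨⟩-+ˡ; scale-l to ⟨⟩-·ˡ)

  ⟨⟩-+ʳ : ∀ x y z → ⟨ x , y +ᵥ z ⟩ ≡ ⟨ x , y ⟩ ℚ.+ ⟨ x , z ⟩
  ⟨⟩-+ʳ x y z = trans (⟨⟩-comm x _) (trans (⟨⟩-+ˡ y z x) (cong₂ ℚ._+_ (⟨⟩-comm y x) (⟨⟩-comm z x)))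

  ⟨⟩-negˡ : ∀ x y → ⟨ -ᵥ x , y ⟩ ≡ ℚ.- ⟨ x , y ⟩
  ⟨⟩-negˡ x y = begin
    ⟨ -ᵥ x , y ⟩                   ≡⟨ cong ⟨_, y ⟩ (-ᵥ≡-1·ᵥ x) ⟩
    ⟨ (ℚ.- 1ℚ) ·ᵥ x , y ⟩          ≡⟨ ⟨⟩-·ˡ (ℚ.- 1ℚ) x y ⟩
    (ℚ.- 1ℚ) ℚ.* ⟨ x , y ⟩         ≡⟨ ℚP.neg-distribˡ-* 1ℚ ⟨ x , y ⟩ ⟨
    ℚ.- (1ℚ ℚ.* ⟨ x , y ⟩)         ≡⟨ cong ℚ.-_ (ℚP.*-identityˡ ⟨ x , y ⟩) ⟩
    ℚ.- ⟨ x , y ⟩                  ∎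
    where open ≡-Reasoning

  ⟨⟩-negʳ : ∀ x y → ⟨ x , -ᵥ y ⟩ ≡ ℚ.- ⟨ x , y ⟩
  ⟨⟩-negʳ x y = trans (⟨⟩-comm x _) (trans (⟨⟩-negˡ y x) (cong ℚ.-_ (⟨⟩-comm y x)))

  ⟨⟩-0ˡ : ∀ y → ⟨ 0ᵥ , y ⟩ ≡ 0ℚ
  ⟨⟩-0ˡ y = trans (cong ⟨_, y ⟩ (sym (·ᵥ-zeroˡ (0ᵥ {n})))) (trans (⟨⟩-·ˡ 0ℚ 0ᵥ y) (ℚP.*-zeroˡ ⟨ 0ᵥ , y ⟩))

  ⟨⟩-sub-self : ∀ x y → ⟨ x -ᵥ y , x -ᵥ y ⟩ ≡ (⟨ x , x ⟩ ℚ.- ⟨ x , y ⟩) ℚ.+ (⟨ y , y ⟩ ℚ.- ⟨ x , y ⟩)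
  ⟨⟩-sub-self x y = begin
    ⟨ x -ᵥ y , x -ᵥ y ⟩                                        ≡⟨ ⟨⟩-+ˡ x (-ᵥ y) _ ⟩
    ⟨ x , x -ᵥ y ⟩ ℚ.+ ⟨ -ᵥ y , x -ᵥ y ⟩                        ≡⟨ cong (⟨ x , x -ᵥ y ⟩ ℚ.+_) (⟨⟩-negˡ y _) ⟩
    ⟨ x , x -ᵥ y ⟩ ℚ.- ⟨ y , x -ᵥ y ⟩                           ≡⟨ cong₂ ℚ._-_ (expand x) (expand y) ⟩
    (⟨ x , x ⟩ ℚ.- ⟨ x , y ⟩) ℚ.- (⟨ y , x ⟩ ℚ.- ⟨ y , y ⟩)    ≡⟨ cong (λ c → A ℚ.- C ℚ.- (c ℚ.- B)) (⟨⟩-comm y x) ⟩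
    (⟨ x , x ⟩ ℚ.- ⟨ x , y ⟩) ℚ.- (⟨ x , y ⟩ ℚ.- ⟨ y , y ⟩)    ≡⟨ solve 3 (λ a b c → (a :+ :- c) :+ :- (c :+ :- b)
                                                                                  := (a :+ :- c) :+ (b :+ :- c)) refl A B C ⟩
    (⟨ x , x ⟩ ℚ.- ⟨ x , y ⟩) ℚ.+ (⟨ y , y ⟩ ℚ.- ⟨ x , y ⟩)    ∎
    where
    open ≡-Reasoning
    A = ⟨ x , x ⟩
    B = ⟨ y , y ⟩
    C = ⟨ x , y ⟩
    expand : ∀ z → ⟨ z , x -ᵥ y ⟩ ≡ ⟨ z , x ⟩ ℚ.- ⟨ z , y ⟩
    expand z = trans (⟨⟩-+ʳ z x (-ᵥ y)) (cong (⟨ z , x ⟩ ℚ.+_) (⟨⟩-negʳ z y))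

  acute-component : ∀ {r} (S : Vec (V n) r) (c : Vec ℕ r) (x : V n) →
                    0ℚ ℚ.< ⟨ lincomb (Vec.map ℕtoℚ c) S , x ⟩ →
                    Σ (V n) λ s → s ∈ S × 0ℚ ℚ.< ⟨ s , x ⟩ ×
                      Σ (Vec ℕ r) λ c′ → suc (Vec.sum c′) ≡ Vec.sum c ×
                        lincomb (Vec.map ℕtoℚ c) S ≡ s +ᵥ lincomb (Vec.map ℕtoℚ c′) S
  acute-component []      []      x 0<⟨0,x⟩ = ⊥-elim (ℚP.<-irrefl (sym (⟨⟩-0ˡ x)) 0<⟨0,x⟩)
  acute-component (s ∷ S) (m ∷ c) x 0<⟨v,x⟩
    with pos-+⇒pos⊎pos (ℕtoℚ m ℚ.* ⟨ s , x ⟩) ⟨ L , x ⟩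
           (subst (0ℚ ℚ.<_) (trans (⟨⟩-+ˡ _ L x) (cong (ℚ._+ ⟨ L , x ⟩) (⟨⟩-·ˡ (ℕtoℚ m) s x))) 0<⟨v,x⟩)
    where L = lincomb (Vec.map ℕtoℚ c) S
  ... | inj₁ 0<m⟨s,x⟩ with m
  ...   | zero  = ⊥-elim (ℚP.<-irrefl (sym (ℚP.*-zeroˡ ⟨ s , x ⟩)) 0<m⟨s,x⟩)
  ...   | suc m′ = s , here refl ,
      ℚP.*-cancelˡ-<-nonNeg (ℕtoℚ (suc m′)) {{ℚ.nonNegative (ℕtoℚ-nonNeg (suc m′))}}
        (subst (ℚ._< ℕtoℚ (suc m′) ℚ.* ⟨ s , x ⟩) (sym (ℚP.*-zeroʳ (ℕtoℚ (suc m′)))) 0<m⟨s,x⟩) ,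
      m′ ∷ c , refl ,
      trans (cong (_+ᵥ _) (suc·ᵥ m′ s)) (Vᴳ.assoc s _ _)
  acute-component (s ∷ S) (m ∷ c) x 0<⟨v,x⟩ | inj₂ 0<⟨L,x⟩
    with acute-component S c x 0<⟨L,x⟩
  ... | s′ , s′∈S , 0<⟨s′,x⟩ , c′ , sum≡ , L≡ = s′ , there s′∈S , 0<⟨s′,x⟩ , m ∷ c′ ,
      trans (sym (ℕP.+-suc m (Vec.sum c′))) (cong (m ℕ.+_) sum≡) ,
      trans (cong (ℕtoℚ m ·ᵥ s +ᵥ_) L≡) (Vᴳ.x∙yz≈y∙xz _ s′ _)

module Roots {n : ℕ} {E : Euclidean n} (Φ : RootSystem E) where
  open Euclidean E renaming (sym to ⟨⟩-comm)
  open RootSystem Φ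
  open InnerProduct E

  Root : V n → Set
  Root α = α LM.∈ roots

  ⟨α,α⟩-pos : ∀ {α} → Root α → 0ℚ ℚ.< ⟨ α , α ⟩
  ⟨α,α⟩-pos α∈Φ = pos-def _ (nonzero α∈Φ)

  neg-root : ∀ {α} → Root α → Root (-ᵥ α)
  neg-root {α} α∈Φ with refl-cryst α∈Φ α∈Φ
  ... | m , 2⟨α,α⟩≡m⟨α,α⟩ , α-mα∈Φ = subst Root (x-2x≡-x α)
    (subst (λ c → Root (α -ᵥ c ·ᵥ α)) (sym m≡2) α-mα∈Φ)
    where
    m≡2 : ℕtoℚ 2 ≡ ℤtoℚ m
    m≡2 = *-cancelʳ-≡-pos ⟨ α , α ⟩ (⟨α,α⟩-pos α∈Φ) 2⟨α,α⟩≡m⟨α,α⟩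

  -- the Cartan integer 2⟨x,y⟩/⟨y,y⟩ is 1 (then s_y x = x - y) or at least 2
  acute-cartan : ∀ {x y} → Root x → Root y → 0ℚ ℚ.< ⟨ x , y ⟩ → Root (x -ᵥ y) ⊎ ⟨ y , y ⟩ ℚ.≤ ⟨ x , y ⟩
  acute-cartan {x} {y} x∈Φ y∈Φ 0<⟨x,y⟩ with refl-cryst y∈Φ x∈Φ
  ... | m , 2⟨x,y⟩≡m⟨y,y⟩ , x-my∈Φ with ℤtoℚ-cases m
  ...   | inj₁ refl = inj₁ (subst (λ z → Root (x -ᵥ z)) (·ᵥ-identityˡ y) x-my∈Φ)
  ...   | inj₂ (inj₁ m≤0) = ⊥-elim (ℚP.<-irrefl refl (begin-strict
    0ℚ                        <⟨ ℚP.*-monoʳ-<-pos (ℕtoℚ 2) {{ℚ.positive (ℕtoℚ-pos 1)}} 0<⟨x,y⟩ ⟩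
    ℕtoℚ 2 ℚ.* ⟨ x , y ⟩     ≡⟨ 2⟨x,y⟩≡m⟨y,y⟩ ⟩
    ℤtoℚ m ℚ.* ⟨ y , y ⟩     ≤⟨ ℚP.*-monoʳ-≤-nonNeg ⟨ y , y ⟩ {{0≤⟨y,y⟩}} m≤0 ⟩
    0ℚ ℚ.* ⟨ y , y ⟩         ≡⟨ ℚP.*-zeroˡ ⟨ y , y ⟩ ⟩
    0ℚ                        ∎))
    where
    open ℚP.≤-Reasoning
    0≤⟨y,y⟩ = ℚ.nonNegative (ℚP.<⇒≤ (⟨α,α⟩-pos y∈Φ))
  ...   | inj₂ (inj₂ 2≤m) = inj₂ (ℚP.*-cancelˡ-≤-pos (ℕtoℚ 2) {{ℚ.positive (ℕtoℚ-pos 1)}} (begin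
    ℕtoℚ 2 ℚ.* ⟨ y , y ⟩     ≤⟨ ℚP.*-monoʳ-≤-nonNeg ⟨ y , y ⟩ {{0≤⟨y,y⟩}} 2≤m ⟩
    ℤtoℚ m ℚ.* ⟨ y , y ⟩     ≡⟨ 2⟨x,y⟩≡m⟨y,y⟩ ⟨
    ℕtoℚ 2 ℚ.* ⟨ x , y ⟩     ∎))
    where
    open ℚP.≤-Reasoning
    0≤⟨y,y⟩ = ℚ.nonNegative (ℚP.<⇒≤ (⟨α,α⟩-pos y∈Φ))

  -- if neither Cartan integer is 1, both are at least 2 and ⟨x - y, x - y⟩ ≤ 0
  acute⇒≡⊎sub : ∀ {x y} → Root x → Root y → 0ℚ ℚ.< ⟨ x , y ⟩ → x ≡ y ⊎ Root (x -ᵥ y)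
  acute⇒≡⊎sub {x} {y} x∈Φ y∈Φ 0<⟨x,y⟩
    with acute-cartan x∈Φ y∈Φ 0<⟨x,y⟩ | acute-cartan y∈Φ x∈Φ (subst (0ℚ ℚ.<_) (⟨⟩-comm x y) 0<⟨x,y⟩)
  ... | inj₁ x-y∈Φ | _          = inj₂ x-y∈Φ
  ... | inj₂ _     | inj₁ y-x∈Φ = inj₂ (subst Root (Vᴳ.⁻¹-anti-homo‿- y x) (neg-root y-x∈Φ))
  ... | inj₂ ⟨y,y⟩≤ | inj₂ ⟨x,x⟩≤ with VecP.≡-dec ℚP._≟_ (x -ᵥ y) 0ᵥ
  ...   | yes x-y≡0 = inj₁ (Vᴳ.x∙y⁻¹≈ε⇒x≈y x y x-y≡0)
  ...   | no  x-y≢0 = ⊥-elim (ℚP.<-irrefl refl (ℚP.<-≤-trans (pos-def _ x-y≢0) (begin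
    ⟨ x -ᵥ y , x -ᵥ y ⟩                                          ≡⟨ ⟨⟩-sub-self x y ⟩
    (⟨ x , x ⟩ ℚ.- ⟨ x , y ⟩) ℚ.+ (⟨ y , y ⟩ ℚ.- ⟨ x , y ⟩)      ≤⟨ ℚP.+-mono-≤ (≤⇒-≤0 ⟨x,x⟩≤⟨x,y⟩) (≤⇒-≤0 ⟨y,y⟩≤) ⟩
    0ℚ ℚ.+ 0ℚ                                                    ≡⟨ ℚP.+-identityˡ 0ℚ ⟩
    0ℚ                                                           ∎)))
    where
    open ℚP.≤-Reasoning
    ⟨x,x⟩≤⟨x,y⟩ = subst (⟨ x , x ⟩ ℚ.≤_) (⟨⟩-comm y x) ⟨x,x⟩≤
    ≤⇒-≤0 : ∀ {p q} → p ℚ.≤ q → p ℚ.- q ℚ.≤ 0ℚ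
    ≤⇒-≤0 {p} {q} p≤q = subst (p ℚ.- q ℚ.≤_) (ℚP.+-inverseʳ q) (ℚP.+-monoˡ-≤ (ℚ.- q) p≤q)

  obtuse⇒≡⊎add : ∀ {x y} → Root x → Root y → ⟨ x , y ⟩ ℚ.< 0ℚ → x ≡ -ᵥ y ⊎ Root (x +ᵥ y)
  obtuse⇒≡⊎add {x} {y} x∈Φ y∈Φ ⟨x,y⟩<0
    with acute⇒≡⊎sub x∈Φ (neg-root y∈Φ) (subst (0ℚ ℚ.<_) (sym (⟨⟩-negʳ x y)) (ℚP.neg-antimono-< ⟨x,y⟩<0))
  ... | inj₁ x≡-y     = inj₁ x≡-y
  ... | inj₂ x-[-y]∈Φ   = inj₂ (subst (λ z → Root (x +ᵥ z)) (Vᴳ.⁻¹-involutive y) x-[-y]∈Φ)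

  -- expand ⟨α + β, γ + δ⟩ = ⟨α + β, α + β⟩ > 0 into four inner products
  acute-summands : ∀ {α β γ δ} → Root (α +ᵥ β) → α +ᵥ β ≡ γ +ᵥ δ →
                   0ℚ ℚ.< ⟨ α , γ ⟩ ⊎ 0ℚ ℚ.< ⟨ α , δ ⟩ ⊎ 0ℚ ℚ.< ⟨ β , γ ⟩ ⊎ 0ℚ ℚ.< ⟨ β , δ ⟩
  acute-summands {α} {β} {γ} {δ} α+β∈Φ α+β≡γ+δ
    with pos-+⇒pos⊎pos _ _ (subst (0ℚ ℚ.<_) expand (⟨α,α⟩-pos α+β∈Φ))
    where
    expand : ⟨ α +ᵥ β , α +ᵥ β ⟩ ≡ (⟨ α , γ ⟩ ℚ.+ ⟨ α , δ ⟩) ℚ.+ (⟨ β , γ ⟩ ℚ.+ ⟨ β , δ ⟩)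
    expand = trans (cong (⟨ α +ᵥ β ,_⟩) α+β≡γ+δ)
      (trans (Euclidean.add-l E α β _) (cong₂ ℚ._+_ (⟨⟩-+ʳ α γ δ) (⟨⟩-+ʳ β γ δ)))
  ... | inj₁ 0<αγ+αδ with pos-+⇒pos⊎pos _ _ 0<αγ+αδ
  ...   | inj₁ 0<αγ = inj₁ 0<αγ
  ...   | inj₂ 0<αδ = inj₂ (inj₁ 0<αδ)
  acute-summands _ _ | inj₂ 0<βγ+βδ with pos-+⇒pos⊎pos _ _ 0<βγ+βδ
  ...   | inj₁ 0<βγ = inj₂ (inj₂ (inj₁ 0<βγ))
  ...   | inj₂ 0<βδ = inj₂ (inj₂ (inj₂ 0<βδ))

module PositiveRoots {n : ℕ} {E : Euclidean n} (Φ : RootSystem E) (S : SimpleSystem Φ) where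
  open Euclidean E renaming (sym to ⟨⟩-comm; add-l to ⟨⟩-+ˡ)
  open RootSystem Φ
  open SimpleSystem S
  open RootPoset Φ S
  open InnerProduct E
  open Roots Φ

  simple⇒Φ⁺ : ∀ {s} → s ∈ simple → Φ⁺ s
  simple⇒Φ⁺ s∈S = in-roots s∈S , Vec.map ℕtoℚ (unit s∈S) , ℕtoℚ-nonNegᵥ (unit s∈S) , sym (lincomb-unit s∈S)

  root-sign : ∀ {α} → Root α → Φ⁺ α ⊎ Φ⁺ (-ᵥ α)
  root-sign α∈Φ with sign α∈Φ
  ... | c , inj₁ (c≥0 , α≡) = inj₁ (α∈Φ , c , c≥0 , α≡)
  ... | c , inj₂ (c≤0 , α≡) = inj₂ (neg-root α∈Φ , -ᵥ c , map⁺ (All.map ℚP.neg-antimono-≤ c≤0) ,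
                                    trans (cong -ᵥ_ α≡) (sym (lincomb-neg c simple)))

  Φ⁺-+ : ∀ {α β} → Φ⁺ α → Φ⁺ β → Root (α +ᵥ β) → Φ⁺ (α +ᵥ β)
  Φ⁺-+ (_ , g , g≥0 , α≡) (_ , h , h≥0 , β≡) α+β∈Φ =
    α+β∈Φ , g +ᵥ h , All.zipWith ℚP.+-mono-≤ g≥0 h≥0 , trans (cong₂ _+ᵥ_ α≡ β≡) (sym (lincomb-+ g h simple))

  Φ⁺⇒¬Φ⁺-neg : ∀ {α} → Φ⁺ α → ¬ Φ⁺ (-ᵥ α)
  Φ⁺⇒¬Φ⁺-neg {α} (α∈Φ , g , g≥0 , α≡) (_ , h , h≥0 , -α≡) = nonzero α∈Φ (begin
    α                   ≡⟨ α≡ ⟩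
    lincomb g simple    ≡⟨ cong (λ c → lincomb c simple) g≡0 ⟩
    lincomb 0ᵥ simple   ≡⟨ lincomb-zero simple ⟩
    0ᵥ                  ∎)
    where
    open ≡-Reasoning
    g≡0 = nonNeg-+≡0ᵥ⇒≡0ᵥ g≥0 h≥0 (lin-ind (g +ᵥ h) (begin
      lincomb (g +ᵥ h) simple                 ≡⟨ lincomb-+ g h simple ⟩
      lincomb g simple +ᵥ lincomb h simple    ≡⟨ cong₂ _+ᵥ_ (sym α≡) (sym -α≡) ⟩
      α -ᵥ α                                  ≡⟨ Vᴳ.inverseʳ α ⟩
      0ᵥ                                      ∎))

  -- the coefficients of α lie under those of s, so α is a nonnegative multiple of s, and Φ is reduced
  Φ⁺-below-simple : ∀ {α s} {h : V n} → Φ⁺ α → All (0ℚ ℚ.≤_) h → s ∈ simple →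
                    α +ᵥ lincomb h simple ≡ s → α ≡ s
  Φ⁺-below-simple {α} {s} {h} (α∈Φ , g , g≥0 , α≡) h≥0 s∈S α+h≡s
    with nonNeg-summand-unit s∈S g≥0 h≥0 (lincomb-injective simple lin-ind (begin
      lincomb (g +ᵥ h) simple                   ≡⟨ lincomb-+ g h simple ⟩
      lincomb g simple +ᵥ lincomb h simple      ≡⟨ cong (_+ᵥ lincomb h simple) (sym α≡) ⟩
      α +ᵥ lincomb h simple                     ≡⟨ α+h≡s ⟩
      s                                         ≡⟨ lincomb-unit s∈S ⟨
      lincomb (Vec.map ℕtoℚ (unit s∈S)) simple  ∎))
    where open ≡-Reasoning
  ... | t , 0≤t , g≡ts with reduced t (in-roots s∈S) (subst Root (trans α≡ g≡ts) α∈Φ)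
  ...   | inj₁ refl = trans α≡ (trans g≡ts (·ᵥ-identityˡ s))
  ...   | inj₂ refl = ⊥-elim (ℚP.<-irrefl refl (ℚP.≤-<-trans 0≤t (ℚP.negative⁻¹ (ℚ.- 1ℚ))))

  ≤Φ-simple⇒≡ : ∀ {γ s} → Φ⁺ γ → s ∈ simple → γ ≤Φ s → γ ≡ s
  ≤Φ-simple⇒≡ γ⁺ s∈S (c , s≡) = Φ⁺-below-simple γ⁺ (ℕtoℚ-nonNegᵥ c) s∈S (sym s≡)

  simple-not-sum : ∀ {α β s} → Φ⁺ α → Φ⁺ β → s ∈ simple → α +ᵥ β ≢ s
  simple-not-sum {α} {β} {s} α⁺ (β∈Φ , h , h≥0 , β≡) s∈S α+β≡s =
    nonzero β∈Φ (Vᴳ.∙-cancelˡ α β 0ᵥ (begin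
      α +ᵥ β    ≡⟨ α+β≡s ⟩
      s         ≡⟨ α≡s ⟨
      α         ≡⟨ Vᴳ.identityʳ α ⟨
      α +ᵥ 0ᵥ   ∎))
    where
    open ≡-Reasoning
    α≡s = Φ⁺-below-simple α⁺ h≥0 s∈S (subst (λ b → α +ᵥ b ≡ s) β≡ α+β≡s)

  ≤Φ-+simple : ∀ {ρ s} → s ∈ simple → ρ ≤Φ (ρ +ᵥ s)
  ≤Φ-+simple {ρ} s∈S = unit s∈S , cong (ρ +ᵥ_) (sym (lincomb-unit s∈S))

  +simple-≤Φ : ∀ {s τ z} → s ∈ simple → z ≡ s +ᵥ τ → τ ≤Φ z
  +simple-≤Φ {s} {τ} s∈S z≡s+τ = subst (τ ≤Φ_) (sym (trans z≡s+τ (Vᴳ.comm s τ))) (≤Φ-+simple s∈S)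

  acute-Φ⁺ : ∀ {x y} → Φ⁺ x → Φ⁺ y → 0ℚ ℚ.< ⟨ x , y ⟩ →
             x ≡ y ⊎ (Σ (V n) λ τ → Φ⁺ τ × x ≡ y +ᵥ τ) ⊎ (Σ (V n) λ τ → Φ⁺ τ × y ≡ x +ᵥ τ)
  acute-Φ⁺ {x} {y} x⁺ y⁺ 0<⟨x,y⟩ with acute⇒≡⊎sub (proj₁ x⁺) (proj₁ y⁺) 0<⟨x,y⟩
  ... | inj₁ x≡y   = inj₁ x≡y
  ... | inj₂ x-y∈Φ with root-sign x-y∈Φ
  ...   | inj₁ x-y⁺    = inj₂ (inj₁ (x -ᵥ y , x-y⁺ , sym (+ᵥ-[-ᵥ] x y)))
  ...   | inj₂ -[x-y]⁺ = inj₂ (inj₂ (y -ᵥ x , subst Φ⁺ (Vᴳ.⁻¹-anti-homo‿- x y) -[x-y]⁺ , sym (+ᵥ-[-ᵥ] y x)))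

  module _ (P : Subset) (P⊆Φ⁺ : ∀ {α} → P α → Φ⁺ α)
           (P-cover : ∀ {ρ s} → Φ⁺ ρ → s ∈ simple → P (ρ +ᵥ s) → P ρ) where

    private
      -- Take s in the support of η = δ - γ with ⟨s, η⟩ > 0. If ⟨δ, s⟩ > 0 then δ - s ∈ Φ⁺ (or δ = s), else
      -- ⟨γ, s⟩ < 0 and γ + s ∈ Φ⁺; in both cases the ℕ-height of η drops by one.
      descend : ∀ h {γ δ} (c : Vec ℕ n) → Vec.sum c ≡ h → Φ⁺ γ → P δ →
                δ ≡ γ +ᵥ lincomb (Vec.map ℕtoℚ c) simple → P γ
      descend h {γ} {δ} c sum≡h γ⁺ Pδ δ≡γ+η with VecP.≡-dec ℚP._≟_ (lincomb (Vec.map ℕtoℚ c) simple) 0ᵥ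
      ... | yes η≡0 = subst P (trans δ≡γ+η (trans (cong (γ +ᵥ_) η≡0) (Vᴳ.identityʳ γ))) Pδ
      ... | no η≢0 with acute-component simple c _ (pos-def _ η≢0) | h
      ...   | _ , _ , _ , _ , 1+sum≡ , _ | zero = ⊥-elim (ℕP.1+n≢0 (trans 1+sum≡ sum≡h))
      ...   | s , s∈S , 0<⟨s,η⟩ , c′ , 1+sum≡ , η≡s+η′ | suc h′ with 0ℚ ℚ.<? ⟨ δ , s ⟩
      ...     | yes 0<⟨δ,s⟩ with acute-Φ⁺ (P⊆Φ⁺ Pδ) (simple⇒Φ⁺ s∈S) 0<⟨δ,s⟩
      ...       | inj₁ δ≡s = subst P (sym (≤Φ-simple⇒≡ γ⁺ s∈S (c , trans (sym δ≡s) δ≡γ+η))) (subst P δ≡s Pδ)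
      ...       | inj₂ (inj₂ (ρ , ρ⁺ , s≡δ+ρ)) = ⊥-elim (simple-not-sum (P⊆Φ⁺ Pδ) ρ⁺ s∈S (sym s≡δ+ρ))
      ...       | inj₂ (inj₁ (τ , τ⁺ , δ≡s+τ)) =
                  descend h′ c′ (ℕP.suc-injective (trans 1+sum≡ sum≡h)) γ⁺ Pτ τ≡γ+η′
        where
        η′ = lincomb (Vec.map ℕtoℚ c′) simple
        Pτ : P τ
        Pτ = P-cover τ⁺ s∈S (subst P (trans δ≡s+τ (Vᴳ.comm s τ)) Pδ)
        τ≡γ+η′ : τ ≡ γ +ᵥ η′
        τ≡γ+η′ = Vᴳ.∙-cancelˡ s τ (γ +ᵥ η′) (begin
          s +ᵥ τ            ≡⟨ δ≡s+τ ⟨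
          δ                 ≡⟨ trans δ≡γ+η (cong (γ +ᵥ_) η≡s+η′) ⟩
          γ +ᵥ (s +ᵥ η′)    ≡⟨ Vᴳ.x∙yz≈y∙xz γ s η′ ⟩
          s +ᵥ (γ +ᵥ η′)    ∎)
          where open ≡-Reasoning
      descend h {γ} {δ} c sum≡h γ⁺ Pδ δ≡γ+η | no η≢0 | s , s∈S , 0<⟨s,η⟩ , c′ , 1+sum≡ , η≡s+η′ | suc h′ | no ¬0<⟨δ,s⟩
        with obtuse⇒≡⊎add (proj₁ γ⁺) (in-roots s∈S) ⟨γ,s⟩<0
        where
        ⟨γ,s⟩<0 : ⟨ γ , s ⟩ ℚ.< 0ℚ
        ⟨γ,s⟩<0 = +-nonPos-pos⇒neg
          (subst (ℚ._≤ 0ℚ) (trans (cong ⟨_, s ⟩ δ≡γ+η) (⟨⟩-+ˡ γ _ s)) (ℚP.≮⇒≥ ¬0<⟨δ,s⟩))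
          (subst (0ℚ ℚ.<_) (⟨⟩-comm s _) 0<⟨s,η⟩)
      ... | inj₁ γ≡-s   = ⊥-elim (Φ⁺⇒¬Φ⁺-neg (simple⇒Φ⁺ s∈S) (subst Φ⁺ γ≡-s γ⁺))
      ... | inj₂ γ+s∈Φ  = P-cover γ⁺ s∈S
        (descend h′ c′ (ℕP.suc-injective (trans 1+sum≡ sum≡h)) (Φ⁺-+ γ⁺ (simple⇒Φ⁺ s∈S) γ+s∈Φ) Pδ
          (trans δ≡γ+η (trans (cong (γ +ᵥ_) η≡s+η′) (sym (Vᴳ.assoc γ s _)))))

    cover-closed⇒down-closed : ∀ {γ δ} → Φ⁺ γ → P δ → γ ≤Φ δ → P γ
    cover-closed⇒down-closed γ⁺ Pδ (c , δ≡) = descend (Vec.sum c) c refl γ⁺ Pδ δ≡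

module Underline {n : ℕ} {E : Euclidean n} (Φ : RootSystem E) (S : SimpleSystem Φ)
                 (k : ℕ) (1≤k : 1 ≤ k) (I : ℕ → RootPoset.Subset Φ S)
                 (I-geometric : RootPoset.IsGeometric Φ S k I) where
  open Euclidean E using (⟨_,_⟩)
  open SimpleSystem S
  open RootPoset Φ S
  open Roots Φ
  open PositiveRoots Φ S

  I̲ : ℕ → Subset
  I̲ = underline k I

  I̲ₖ₊₁ : Subset
  I̲ₖ₊₁ = top k I

  I̲ₑ : ℕ → Subset
  I̲ₑ = Iₑ (suc k) I̲

  I-ideal : ∀ a → 1 ≤ a → a ≤ k → IsIdeal (I a)
  I-ideal = proj₁ (proj₁ I-geometric)

  I-nested : ∀ a b → 1 ≤ a → a ≤ b → b ≤ k → ∀ {α} → I a α → I b α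
  I-nested = proj₂ (proj₁ I-geometric)

  I-closed : ∀ i j → i ℕ.+ j ≤ k → ∀ {α β} → Iₑ k I i α → Iₑ k I j β →
             Φ⁺ (α +ᵥ β) → Iₑ k I (i ℕ.+ j) (α +ᵥ β)
  I-closed = proj₁ (proj₂ I-geometric)

  J-closed : ∀ i j → i ≤ k → j ≤ k → ∀ {α β} → Jₑ k I i α → Jₑ k I j β →
             Φ⁺ (α +ᵥ β) → Jₑ k I (i ℕ.+ j) (α +ᵥ β)
  J-closed = proj₂ (proj₂ I-geometric)

  I⊆Φ⁺ : ∀ {a α} → 1 ≤ a → a ≤ k → I a α → Φ⁺ α
  I⊆Φ⁺ 1≤a a≤k = proj₁ (I-ideal _ 1≤a a≤k)

  I-down : ∀ {a α β} → 1 ≤ a → a ≤ k → Φ⁺ α → I a β → α ≤Φ β → I a α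
  I-down 1≤a a≤k = proj₂ (I-ideal _ 1≤a a≤k)

  I⊆I̲ₖ₊₁ : ∀ {a α} → 1 ≤ a → a ≤ k → I a α → I̲ₖ₊₁ α
  I⊆I̲ₖ₊₁ 1≤a a≤k Iα = inj₂ (inj₁ (I-nested _ k 1≤a a≤k ℕP.≤-refl Iα))

  I≤ : ℕ → Subset
  I≤ m α = Σ ℕ λ a → 1 ≤ a × a ≤ k × a ≤ m × I a α

  I≤-mono : ∀ {m m′ α} → m ≤ m′ → I≤ m α → I≤ m′ α
  I≤-mono m≤m′ (a , 1≤a , a≤k , a≤m , Iα) = a , 1≤a , a≤k , ℕP.≤-trans a≤m m≤m′ , Iα

  Iₑ⇒I≤ : ∀ {m α} → Iₑ k I m α → I≤ m α
  Iₑ⇒I≤ {m} (1≤m , Iα) = m ⊓ k , ℕP.⊓-glb 1≤m 1≤k , ℕP.m⊓n≤n m k , ℕP.m⊓n≤m m k , Iα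

  I≤⇒Iₑ : ∀ {m α} → I≤ m α → Iₑ k I m α
  I≤⇒Iₑ {m} (a , 1≤a , a≤k , a≤m , Iα) =
    ℕP.≤-trans 1≤a a≤m , I-nested a (m ⊓ k) 1≤a (ℕP.⊓-glb a≤m a≤k) (ℕP.m⊓n≤n m k) Iα

  I̲ₑ⇒I≤⊎I̲ₖ₊₁ : ∀ {m α} → I̲ₑ m α → I≤ m α ⊎ (suc k ≤ m × I̲ₖ₊₁ α)
  I̲ₑ⇒I≤⊎I̲ₖ₊₁ {m} (1≤m , inj₁ (m⊓k+1≤k , Iα)) =
    inj₁ (m ⊓ suc k , ℕP.⊓-glb 1≤m (s≤s z≤n) , m⊓k+1≤k , ℕP.m⊓n≤m m (suc k) , Iα)
  I̲ₑ⇒I≤⊎I̲ₖ₊₁ {m} (1≤m , inj₂ (k+1≤m⊓k+1 , Tα)) = inj₂ (ℕP.≤-trans k+1≤m⊓k+1 (ℕP.m⊓n≤m m (suc k)) , Tα)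

  I≤⇒I̲ₑ : ∀ {m α} → I≤ m α → I̲ₑ m α
  I≤⇒I̲ₑ {m} {α} (a , 1≤a , a≤k , a≤m , Iα) with m ℕ.≤? k
  ... | yes m≤k = ℕP.≤-trans 1≤a a≤m ,
        subst (λ i → I̲ i α) (sym (ℕP.m≤n⇒m⊓n≡m (ℕP.m≤n⇒m≤1+n m≤k))) (inj₁ (m≤k , I-nested a m 1≤a a≤m m≤k Iα))
  ... | no m≰k = ℕP.≤-trans 1≤a a≤m ,
        subst (λ i → I̲ i α) (sym (ℕP.m≥n⇒m⊓n≡n (ℕP.≰⇒> m≰k))) (inj₂ (ℕP.≤-refl , I⊆I̲ₖ₊₁ 1≤a a≤k Iα))

  I̲ₖ₊₁⇒I̲ₑ : ∀ {m α} → suc k ≤ m → I̲ₖ₊₁ α → I̲ₑ m α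
  I̲ₖ₊₁⇒I̲ₑ {m} {α} k+1≤m Tα = ℕP.≤-trans (s≤s z≤n) k+1≤m ,
    subst (λ i → I̲ i α) (sym (ℕP.m≥n⇒m⊓n≡n k+1≤m)) (inj₂ (ℕP.≤-refl , Tα))

  I̲ₑ-mono : ∀ {m m′ α} → m ≤ m′ → I̲ₑ m α → I̲ₑ m′ α
  I̲ₑ-mono m≤m′ Iα with I̲ₑ⇒I≤⊎I̲ₖ₊₁ Iα
  ... | inj₁ I≤α          = I≤⇒I̲ₑ (I≤-mono m≤m′ I≤α)
  ... | inj₂ (k+1≤m , Tα) = I̲ₖ₊₁⇒I̲ₑ (ℕP.≤-trans k+1≤m m≤m′) Tα

  I̲ₑ⇒I : ∀ {m α} → m ≤ k → I̲ₑ m α → I m α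
  I̲ₑ⇒I m≤k Iα with I̲ₑ⇒I≤⊎I̲ₖ₊₁ Iα
  ... | inj₁ (a , 1≤a , a≤k , a≤m , Iaα) = I-nested _ _ 1≤a a≤m m≤k Iaα
  ... | inj₂ (k+1≤m , _)                  = ⊥-elim (ℕP.<⇒≱ k+1≤m m≤k)

  I̲ₖ₊₁⊆Φ⁺ : ∀ {α} → I̲ₖ₊₁ α → Φ⁺ α
  I̲ₖ₊₁⊆Φ⁺ (inj₁ (_ , _ , _ , _ , _ , _ , _ , _ , _ , _ , α⁺)) = α⁺
  I̲ₖ₊₁⊆Φ⁺ (inj₂ (inj₁ Ikα))                                   = I⊆Φ⁺ 1≤k ℕP.≤-refl Ikα
  I̲ₖ₊₁⊆Φ⁺ (inj₂ (inj₂ α∈S))                                   = simple⇒Φ⁺ α∈S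

  -- y + z is one of the sums (Iₐ + I_b) ∩ Φ⁺, a + b = k + 1, making up I̲ₖ₊₁
  Split : ℕ → ℕ → V n → V n → Set
  Split a b y z = 1 ≤ a × 1 ≤ b × a ℕ.+ b ≡ suc k × I a y × I b z

  Split-swap : ∀ {a b y z} → Split a b y z → Split b a z y
  Split-swap {a} {b} (1≤a , 1≤b , a+b≡ , Iay , Ibz) = 1≤b , 1≤a , trans (ℕP.+-comm b a) a+b≡ , Ibz , Iay

  Split-≤kˡ : ∀ {a b y z} → Split a b y z → a ≤ k
  Split-≤kˡ {a} {b} (_ , 1≤b , a+b≡ , _) = +≤1+⇒≤ (ℕP.≤-reflexive (trans (ℕP.+-comm b a) a+b≡)) 1≤b

  Split-Iˡ : ∀ {a b y z} → Split a b y z → I a y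
  Split-Iˡ (_ , _ , _ , Iay , _) = Iay

  Split-Φ⁺ˡ : ∀ {a b y z} → Split a b y z → Φ⁺ y
  Split-Φ⁺ˡ sp@(1≤a , _) = I⊆Φ⁺ 1≤a (Split-≤kˡ sp) (Split-Iˡ sp)

  Split⇒I̲ₖ₊₁ : ∀ {a b y z} → Split a b y z → Φ⁺ (y +ᵥ z) → I̲ₖ₊₁ (y +ᵥ z)
  Split⇒I̲ₖ₊₁ {a} {b} {y} {z} (1≤a , 1≤b , a+b≡ , Iay , Ibz) y+z⁺ =
    inj₁ (a , b , 1≤a , 1≤b , a+b≡ , y , z , Iay , Ibz , refl , y+z⁺)

  Split-downʳ : ∀ {a b y z τ} → Split a b y z → Φ⁺ τ → τ ≤Φ z → Split a b y τ
  Split-downʳ sp@(1≤a , 1≤b , a+b≡ , Iay , Ibz) τ⁺ τ≤z =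
    1≤a , 1≤b , a+b≡ , Iay , I-down 1≤b (Split-≤kˡ (Split-swap sp)) τ⁺ Ibz τ≤z

  I̲ₖ₊₁-cover-ρ : ∀ {ρ s a b y z} → Split a b y z → ρ +ᵥ s ≡ y +ᵥ z → Φ⁺ ρ → s ∈ simple →
                 0ℚ ℚ.< ⟨ ρ , y ⟩ → I̲ₖ₊₁ ρ
  I̲ₖ₊₁-cover-ρ sp ρ+s≡y+z ρ⁺ s∈S 0<⟨ρ,y⟩ with acute-Φ⁺ ρ⁺ (Split-Φ⁺ˡ sp) 0<⟨ρ,y⟩
  ... | inj₁ ρ≡y = subst I̲ₖ₊₁ (sym ρ≡y) (I⊆I̲ₖ₊₁ (proj₁ sp) (Split-≤kˡ sp) (Split-Iˡ sp))
  ... | inj₂ (inj₁ (τ , τ⁺ , ρ≡y+τ)) = subst I̲ₖ₊₁ (sym ρ≡y+τ)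
        (Split⇒I̲ₖ₊₁ (Split-downʳ sp τ⁺ (+simple-≤Φ s∈S (+ᵥ-exchange ρ≡y+τ ρ+s≡y+z))) (subst Φ⁺ ρ≡y+τ ρ⁺))
  ... | inj₂ (inj₂ (τ , τ⁺ , y≡ρ+τ)) = ⊥-elim (simple-not-sum (Split-Φ⁺ˡ (Split-swap sp)) τ⁺ s∈S
        (sym (+ᵥ-exchange y≡ρ+τ (sym ρ+s≡y+z))))

  I̲ₖ₊₁-cover-s : ∀ {ρ s a b y z} → Split a b y z → ρ +ᵥ s ≡ y +ᵥ z → Φ⁺ ρ → s ∈ simple →
                 0ℚ ℚ.< ⟨ s , y ⟩ → I̲ₖ₊₁ ρ
  I̲ₖ₊₁-cover-s {ρ} {s} {y = y} {z} sp ρ+s≡y+z ρ⁺ s∈S 0<⟨s,y⟩ with acute-Φ⁺ (simple⇒Φ⁺ s∈S) (Split-Φ⁺ˡ sp) 0<⟨s,y⟩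
  ... | inj₁ refl = subst I̲ₖ₊₁ (sym ρ≡z) (I⊆I̲ₖ₊₁ (proj₁ sb) (Split-≤kˡ sb) (Split-Iˡ sb))
    where
    sb = Split-swap sp
    ρ≡z : ρ ≡ z
    ρ≡z = Vᴳ.∙-cancelˡ s ρ z (trans (Vᴳ.comm s ρ) ρ+s≡y+z)
  ... | inj₂ (inj₁ (τ , τ⁺ , s≡y+τ)) = ⊥-elim (simple-not-sum (Split-Φ⁺ˡ sp) τ⁺ s∈S (sym s≡y+τ))
  ... | inj₂ (inj₂ (τ , τ⁺ , y≡s+τ)) = subst I̲ₖ₊₁ (sym ρ≡z+τ)
        (Split⇒I̲ₖ₊₁ (Split-downʳ (Split-swap sp) τ⁺ (+simple-≤Φ s∈S y≡s+τ)) (subst Φ⁺ ρ≡z+τ ρ⁺))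
    where
    ρ≡z+τ : ρ ≡ z +ᵥ τ
    ρ≡z+τ = +ᵥ-exchange y≡s+τ (trans (sym ρ+s≡y+z) (Vᴳ.comm ρ s))

  I̲ₖ₊₁-cover-Split : ∀ {ρ s a b y z} → Split a b y z → ρ +ᵥ s ≡ y +ᵥ z → Root (ρ +ᵥ s) → Φ⁺ ρ → s ∈ simple →
                      I̲ₖ₊₁ ρ
  I̲ₖ₊₁-cover-Split {y = y} {z} sp ρ+s≡y+z ρ+s∈Φ ρ⁺ s∈S with acute-summands ρ+s∈Φ ρ+s≡y+z
  ... | inj₁ 0<⟨ρ,y⟩               = I̲ₖ₊₁-cover-ρ sp ρ+s≡y+z ρ⁺ s∈S 0<⟨ρ,y⟩
  ... | inj₂ (inj₁ 0<⟨ρ,z⟩)        = I̲ₖ₊₁-cover-ρ (Split-swap sp) (trans ρ+s≡y+z (Vᴳ.comm y z)) ρ⁺ s∈S 0<⟨ρ,z⟩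
  ... | inj₂ (inj₂ (inj₁ 0<⟨s,y⟩)) = I̲ₖ₊₁-cover-s sp ρ+s≡y+z ρ⁺ s∈S 0<⟨s,y⟩
  ... | inj₂ (inj₂ (inj₂ 0<⟨s,z⟩)) = I̲ₖ₊₁-cover-s (Split-swap sp) (trans ρ+s≡y+z (Vᴳ.comm y z)) ρ⁺ s∈S 0<⟨s,z⟩

  I̲ₖ₊₁-cover : ∀ {ρ s} → Φ⁺ ρ → s ∈ simple → I̲ₖ₊₁ (ρ +ᵥ s) → I̲ₖ₊₁ ρ
  I̲ₖ₊₁-cover ρ⁺ s∈S (inj₂ (inj₁ Ikρ+s)) = inj₂ (inj₁ (I-down 1≤k ℕP.≤-refl ρ⁺ Ikρ+s (≤Φ-+simple s∈S)))
  I̲ₖ₊₁-cover ρ⁺ s∈S (inj₂ (inj₂ ρ+s∈S)) = ⊥-elim (simple-not-sum ρ⁺ (simple⇒Φ⁺ s∈S) ρ+s∈S refl)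
  I̲ₖ₊₁-cover ρ⁺ s∈S (inj₁ (_ , _ , 1≤a , 1≤b , a+b≡ , _ , _ , Iay , Ibz , ρ+s≡y+z , ρ+s⁺)) =
    I̲ₖ₊₁-cover-Split (1≤a , 1≤b , a+b≡ , Iay , Ibz) ρ+s≡y+z (proj₁ ρ+s⁺) ρ⁺ s∈S

  I̲ₖ₊₁-down : ∀ {α β} → Φ⁺ α → I̲ₖ₊₁ β → α ≤Φ β → I̲ₖ₊₁ α
  I̲ₖ₊₁-down = cover-closed⇒down-closed I̲ₖ₊₁ I̲ₖ₊₁⊆Φ⁺ I̲ₖ₊₁-cover

  I̲⇒I : ∀ {i α} → i ≤ k → I̲ i α → I i α
  I̲⇒I i≤k (inj₁ (_ , Iα))          = Iα
  I̲⇒I i≤k (inj₂ (k+1≤i , _))       = ⊥-elim (ℕP.<⇒≱ k+1≤i i≤k)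

  I̲⇒I̲ₖ₊₁ : ∀ {i α} → suc k ≤ i → I̲ i α → I̲ₖ₊₁ α
  I̲⇒I̲ₖ₊₁ k+1≤i (inj₁ (i≤k , _))    = ⊥-elim (ℕP.<⇒≱ k+1≤i i≤k)
  I̲⇒I̲ₖ₊₁ k+1≤i (inj₂ (_ , Tα))     = Tα

  I̲-ideal : ∀ i → 1 ≤ i → i ≤ suc k → IsIdeal (I̲ i)
  I̲-ideal i 1≤i _ with i ℕ.≤? k
  ... | yes i≤k = (λ Iα → I⊆Φ⁺ 1≤i i≤k (I̲⇒I i≤k Iα)) ,
                  (λ α⁺ Iβ α≤β → inj₁ (i≤k , I-down 1≤i i≤k α⁺ (I̲⇒I i≤k Iβ) α≤β))
  ... | no i≰k  = (λ Iα → I̲ₖ₊₁⊆Φ⁺ (I̲⇒I̲ₖ₊₁ k+1≤i Iα)) ,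
                  (λ α⁺ Iβ α≤β → inj₂ (k+1≤i , I̲ₖ₊₁-down α⁺ (I̲⇒I̲ₖ₊₁ k+1≤i Iβ) α≤β))
    where k+1≤i = ℕP.≰⇒> i≰k

  I̲-nested : ∀ i j → 1 ≤ i → i ≤ j → j ≤ suc k → ∀ {α} → I̲ i α → I̲ j α
  I̲-nested i j 1≤i i≤j _ (inj₁ (i≤k , Iiα)) with j ℕ.≤? k
  ... | yes j≤k = inj₁ (j≤k , I-nested i j 1≤i i≤j j≤k Iiα)
  ... | no j≰k  = inj₂ (ℕP.≰⇒> j≰k , I⊆I̲ₖ₊₁ 1≤i i≤k Iiα)
  I̲-nested i j 1≤i i≤j _ (inj₂ (k+1≤i , Tα)) = inj₂ (ℕP.≤-trans k+1≤i i≤j , Tα)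

  -- a + d ≤ k is the I-condition of I; a + d = k + 1 is the definition of I̲ₖ₊₁
  I-sum : ∀ {a d y τ} → 1 ≤ a → 1 ≤ d → a ≤ k → d ≤ k → a ℕ.+ d ≤ suc k →
          I a y → I d τ → Φ⁺ (y +ᵥ τ) → I̲ₑ (a ℕ.+ d) (y +ᵥ τ)
  I-sum {a} {d} 1≤a 1≤d a≤k d≤k a+d≤k+1 Iay Idτ y+τ⁺ with (a ℕ.+ d) ℕ.≤? k
  ... | yes a+d≤k = I≤⇒I̲ₑ (Iₑ⇒I≤ (I-closed a d a+d≤k
                      (I≤⇒Iₑ (a , 1≤a , a≤k , ℕP.≤-refl , Iay)) (I≤⇒Iₑ (d , 1≤d , d≤k , ℕP.≤-refl , Idτ)) y+τ⁺))
  ... | no a+d≰k  = I̲ₖ₊₁⇒I̲ₑ k<a+d (Split⇒I̲ₖ₊₁ (1≤a , 1≤d , ℕP.≤-antisym a+d≤k+1 k<a+d , Iay , Idτ) y+τ⁺)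
    where k<a+d = ℕP.≰⇒> a+d≰k

  I̲-I-closed : ∀ i j → i ℕ.+ j ≤ suc k → ∀ {α β} → I̲ₑ i α → I̲ₑ j β →
               Φ⁺ (α +ᵥ β) → I̲ₑ (i ℕ.+ j) (α +ᵥ β)
  I̲-I-closed i j i+j≤k+1 Iα Iβ α+β⁺ with I̲ₑ⇒I≤⊎I̲ₖ₊₁ Iα | I̲ₑ⇒I≤⊎I̲ₖ₊₁ Iβ
  ... | inj₁ (a , 1≤a , a≤k , a≤i , Iaα) | inj₁ (d , 1≤d , d≤k , d≤j , Idβ) =
        I̲ₑ-mono a+d≤i+j (I-sum 1≤a 1≤d a≤k d≤k (ℕP.≤-trans a+d≤i+j i+j≤k+1) Iaα Idβ α+β⁺)
    where a+d≤i+j = ℕP.+-mono-≤ a≤i d≤j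
  ... | inj₂ (k+1≤i , _) | _ = ⊥-elim (x+y≰m k+1≤i (proj₁ Iβ) i+j≤k+1)
  ... | inj₁ _ | inj₂ (k+1≤j , _) = ⊥-elim (x+y≰m k+1≤j (proj₁ Iα) (subst (_≤ suc k) (ℕP.+-comm i j) i+j≤k+1))

  ¬I̲ₑ⇒¬Iₑ : ∀ {m α} → ¬ I̲ₑ m α → ¬ Iₑ k I (m ⊓ k) α
  ¬I̲ₑ⇒¬Iₑ {m} ¬Iα Iα = ¬Iα (I≤⇒I̲ₑ (I≤-mono (ℕP.m⊓n≤m m k) (Iₑ⇒I≤ Iα)))

  ¬I̲ₑ-0 : ∀ {α} → ¬ I̲ₑ 0 α
  ¬I̲ₑ-0 (() , _)

  J-sum : ∀ {i j α β} → ¬ I̲ₑ i α → ¬ I̲ₑ j β → Φ⁺ α → Φ⁺ β → Φ⁺ (α +ᵥ β) → ¬ I≤ (i ℕ.+ j) (α +ᵥ β)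
  J-sum {i} {j} ¬Iα ¬Iβ α⁺ β⁺ α+β⁺ (a , 1≤a , a≤k , a≤i+j , Iα+β) =
    proj₂ (J-closed (i ⊓ k) (j ⊓ k) (ℕP.m⊓n≤n i k) (ℕP.m⊓n≤n j k)
             (α⁺ , ¬I̲ₑ⇒¬Iₑ ¬Iα) (β⁺ , ¬I̲ₑ⇒¬Iₑ ¬Iβ) α+β⁺)
      (I≤⇒Iₑ (a , 1≤a , a≤k , ≤⇒≤⊓+⊓ {i = i} {j} a≤k a≤i+j , Iα+β))

  -- τ ∉ I̲_d for d = i - a (else x = y + τ ∈ I̲ᵢ), and then z = v + τ ∈ I_b with b ≤ j + d violates the J-condition of I
  J-split-sub : ∀ {i j a b x v y z τ} → Split a b y z → suc k ≤ i ℕ.+ j → i ≤ suc k →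
                ¬ I̲ₑ i x → ¬ I̲ₑ j v → Φ⁺ x → Φ⁺ v → Φ⁺ τ → x ≡ y +ᵥ τ → z ≡ v +ᵥ τ → ⊥
  J-split-sub {i} {j} {a} {b} {x} {v} {y} {z} {τ} sp@(1≤a , 1≤b , a+b≡ , Iay , Ibz)
              k+1≤i+j i≤k+1 ¬Ix ¬Iv x⁺ v⁺ τ⁺ x≡y+τ z≡v+τ =
    J-sum ¬Iv ¬Iτ v⁺ τ⁺ v+τ⁺ (b , 1≤b , b≤k , b≤j+d , Iv+τ)
    where
    a≤k = Split-≤kˡ sp
    b≤k = Split-≤kˡ (Split-swap sp)
    Iv+τ : I b (v +ᵥ τ)
    Iv+τ = subst (I b) z≡v+τ Ibz
    v+τ⁺ = I⊆Φ⁺ 1≤b b≤k Iv+τ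
    j<b : j ℕ.< b
    j<b = ℕP.≰⇒> (λ b≤j → J-sum ¬Iv ¬I̲ₑ-0 v⁺ τ⁺ v+τ⁺ (b , 1≤b , b≤k , ℕP.≤-trans b≤j (ℕP.m≤m+n j 0) , Iv+τ))
    a<i : a ℕ.< i
    a<i = ℕP.≰⇒> (λ i≤a → ℕP.<⇒≱ (subst (i ℕ.+ j ℕ.<_) a+b≡ (ℕP.+-mono-≤-< i≤a j<b)) k+1≤i+j)
    d = i ∸ a
    a+d≡i : a ℕ.+ d ≡ i
    a+d≡i = ℕP.m+[n∸m]≡n (ℕP.<⇒≤ a<i)
    a+d≤k+1 : a ℕ.+ d ≤ suc k
    a+d≤k+1 = subst (_≤ suc k) (sym a+d≡i) i≤k+1
    d≤k : d ≤ k
    d≤k = +≤1+⇒≤ a+d≤k+1 1≤a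
    ¬Iτ : ¬ I̲ₑ d τ
    ¬Iτ Iτ = ¬Ix (subst₂ I̲ₑ a+d≡i (sym x≡y+τ)
      (I-sum 1≤a (ℕP.m<n⇒0<n∸m a<i) a≤k d≤k a+d≤k+1 Iay (I̲ₑ⇒I d≤k Iτ) (subst Φ⁺ x≡y+τ x⁺)))
    b≤j+d : b ≤ j ℕ.+ d
    b≤j+d = ℕP.+-cancelˡ-≤ a b (j ℕ.+ d) (begin
      a ℕ.+ b            ≡⟨ a+b≡ ⟩
      suc k              ≤⟨ k+1≤i+j ⟩
      i ℕ.+ j            ≡⟨ cong (ℕ._+ j) a+d≡i ⟨
      a ℕ.+ d ℕ.+ j      ≡⟨ ℕP.+-assoc a d j ⟩
      a ℕ.+ (d ℕ.+ j)    ≡⟨ cong (a ℕ.+_) (ℕP.+-comm d j) ⟩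
      a ℕ.+ (j ℕ.+ d)    ∎)
      where open ℕP.≤-Reasoning

  J-split-≡ : ∀ {i j a b x v y z} → Split a b y z → suc k ≤ i ℕ.+ j →
              ¬ I̲ₑ i x → ¬ I̲ₑ j v → x +ᵥ v ≡ y +ᵥ z → x ≡ y → ⊥
  J-split-≡ {i} {j} {a} {b} {x} {v} {z = z} sp@(1≤a , 1≤b , a+b≡ , Iay , Ibz) k+1≤i+j ¬Ix ¬Iv x+v≡x+z refl =
    ℕP.<⇒≱ (subst (i ℕ.+ j ℕ.<_) a+b≡ (ℕP.+-mono-< i<a j<b)) k+1≤i+j
    where
    i<a : i ℕ.< a
    i<a = ℕP.≰⇒> (λ a≤i → ¬Ix (I≤⇒I̲ₑ (a , 1≤a , Split-≤kˡ sp , a≤i , Iay)))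
    j<b : j ℕ.< b
    j<b = ℕP.≰⇒> (λ b≤j → ¬Iv (I≤⇒I̲ₑ (b , 1≤b , Split-≤kˡ (Split-swap sp) , b≤j ,
            subst (I b) (sym (Vᴳ.∙-cancelˡ x v z x+v≡x+z)) Ibz)))

  J-split : ∀ {i j a b x v y z} → Split a b y z → suc k ≤ i ℕ.+ j → i ≤ suc k → j ≤ suc k →
            ¬ I̲ₑ i x → ¬ I̲ₑ j v → Φ⁺ x → Φ⁺ v → x +ᵥ v ≡ y +ᵥ z → 0ℚ ℚ.< ⟨ x , y ⟩ → ⊥
  J-split {i} {j} sp k+1≤i+j i≤k+1 j≤k+1 ¬Ix ¬Iv x⁺ v⁺ x+v≡y+z 0<⟨x,y⟩ with acute-Φ⁺ x⁺ (Split-Φ⁺ˡ sp) 0<⟨x,y⟩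
  ... | inj₁ x≡y = J-split-≡ sp k+1≤i+j ¬Ix ¬Iv x+v≡y+z x≡y
  ... | inj₂ (inj₁ (τ , τ⁺ , x≡y+τ)) =
        J-split-sub sp k+1≤i+j i≤k+1 ¬Ix ¬Iv x⁺ v⁺ τ⁺ x≡y+τ (+ᵥ-exchange x≡y+τ x+v≡y+z)
  ... | inj₂ (inj₂ (τ , τ⁺ , y≡x+τ)) =
        J-split-sub (Split-swap sp) (subst (suc k ≤_) (ℕP.+-comm i j) k+1≤i+j) j≤k+1 ¬Iv ¬Ix v⁺ x⁺ τ⁺
          (+ᵥ-exchange y≡x+τ (sym x+v≡y+z)) y≡x+τ

  J-sum-∉Split : ∀ {i j a b α β y z} → Split a b y z → i ≤ suc k → j ≤ suc k → suc k ≤ i ℕ.+ j →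
                 ¬ I̲ₑ i α → ¬ I̲ₑ j β → Φ⁺ α → Φ⁺ β → α +ᵥ β ≡ y +ᵥ z → Root (α +ᵥ β) → ⊥
  J-sum-∉Split {i} {j} {α = α} {β} {y} {z} sp i≤k+1 j≤k+1 k+1≤i+j ¬Iα ¬Iβ α⁺ β⁺ α+β≡y+z α+β∈Φ
    with acute-summands α+β∈Φ α+β≡y+z
  ... | inj₁ 0<⟨α,y⟩               = J-split sp k+1≤i+j i≤k+1 j≤k+1 ¬Iα ¬Iβ α⁺ β⁺ α+β≡y+z 0<⟨α,y⟩
  ... | inj₂ (inj₁ 0<⟨α,z⟩)        = J-split (Split-swap sp) k+1≤i+j i≤k+1 j≤k+1 ¬Iα ¬Iβ α⁺ β⁺
                                       (trans α+β≡y+z (Vᴳ.comm y z)) 0<⟨α,z⟩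
  ... | inj₂ (inj₂ (inj₁ 0<⟨β,y⟩)) = J-split sp k+1≤j+i j≤k+1 i≤k+1 ¬Iβ ¬Iα β⁺ α⁺
                                       (trans (Vᴳ.comm β α) α+β≡y+z) 0<⟨β,y⟩
    where k+1≤j+i = subst (suc k ≤_) (ℕP.+-comm i j) k+1≤i+j
  ... | inj₂ (inj₂ (inj₂ 0<⟨β,z⟩)) = J-split (Split-swap sp) k+1≤j+i j≤k+1 i≤k+1 ¬Iβ ¬Iα β⁺ α⁺
                                       (trans (Vᴳ.comm β α) (trans α+β≡y+z (Vᴳ.comm y z))) 0<⟨β,z⟩
    where k+1≤j+i = subst (suc k ≤_) (ℕP.+-comm i j) k+1≤i+j

  J-sum-∉I̲ₖ₊₁ : ∀ {i j α β} → i ≤ suc k → j ≤ suc k → suc k ≤ i ℕ.+ j →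
                ¬ I̲ₑ i α → ¬ I̲ₑ j β → Φ⁺ α → Φ⁺ β → ¬ I̲ₖ₊₁ (α +ᵥ β)
  J-sum-∉I̲ₖ₊₁ i≤k+1 j≤k+1 k+1≤i+j ¬Iα ¬Iβ α⁺ β⁺ (inj₂ (inj₁ Ikα+β)) =
    J-sum ¬Iα ¬Iβ α⁺ β⁺ (I⊆Φ⁺ 1≤k ℕP.≤-refl Ikα+β)
      (k , 1≤k , ℕP.≤-refl , ℕP.≤-trans (ℕP.n≤1+n k) k+1≤i+j , Ikα+β)
  J-sum-∉I̲ₖ₊₁ _ _ _ _ _ α⁺ β⁺ (inj₂ (inj₂ α+β∈S)) = simple-not-sum α⁺ β⁺ α+β∈S refl
  J-sum-∉I̲ₖ₊₁ i≤k+1 j≤k+1 k+1≤i+j ¬Iα ¬Iβ α⁺ β⁺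
    (inj₁ (_ , _ , 1≤a , 1≤b , a+b≡ , _ , _ , Iay , Ibz , α+β≡y+z , α+β⁺)) =
    J-sum-∉Split (1≤a , 1≤b , a+b≡ , Iay , Ibz) i≤k+1 j≤k+1 k+1≤i+j ¬Iα ¬Iβ α⁺ β⁺ α+β≡y+z (proj₁ α+β⁺)

  I̲-J-closed : ∀ i j → i ≤ suc k → j ≤ suc k → ∀ {α β} → Jₑ (suc k) I̲ i α → Jₑ (suc k) I̲ j β →
               Φ⁺ (α +ᵥ β) → Jₑ (suc k) I̲ (i ℕ.+ j) (α +ᵥ β)
  I̲-J-closed i j i≤k+1 j≤k+1 {α} {β} (α⁺ , ¬Iα) (β⁺ , ¬Iβ) α+β⁺ =
    α+β⁺ , λ Iα+β → ∉ (I̲ₑ⇒I≤⊎I̲ₖ₊₁ Iα+β)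
    where
    ∉ : ¬ (I≤ (i ℕ.+ j) (α +ᵥ β) ⊎ (suc k ≤ i ℕ.+ j × I̲ₖ₊₁ (α +ᵥ β)))
    ∉ (inj₁ I≤α+β)             = J-sum ¬Iα ¬Iβ α⁺ β⁺ α+β⁺ I≤α+β
    ∉ (inj₂ (k+1≤i+j , Tα+β))  = J-sum-∉I̲ₖ₊₁ i≤k+1 j≤k+1 k+1≤i+j ¬Iα ¬Iβ α⁺ β⁺ Tα+β

  I̲-geometric : IsGeometric (suc k) I̲
  I̲-geometric = (I̲-ideal , I̲-nested) , I̲-I-closed , I̲-J-closed

  I̲-positive : IsPositive (suc k) I̲
  I̲-positive s∈S = inj₂ (ℕP.≤-refl , inj₂ (inj₂ s∈S))

  θ⁻¹-I̲⊆θ⁻¹-I : ∀ x → θ⁻¹ (suc k) I̲ x → θ⁻¹ k I x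
  θ⁻¹-I̲⊆θ⁻¹-I x x∈R̲ α α⁺ = proj₁ (x∈R̲ α α⁺) , λ i 1≤i i≤k →
    let below , above = proj₂ (x∈R̲ α α⁺) i 1≤i (ℕP.m≤n⇒m≤1+n i≤k)
    in (λ Iiα → below (inj₁ (i≤k , Iiα))) , (λ ¬Iiα → above (λ I̲iα → ¬Iiα (I̲⇒I i≤k I̲iα)))

lemma6 : ∀ {n} (E : Euclidean n) (Φ : RootSystem E) → Irreducible Φ →
         (S : SimpleSystem Φ) → (k : ℕ) → 1 ≤ k →
         (I : ℕ → RootPoset.Subset Φ S) →
         RootPoset.IsGeometric Φ S k I →
         RootPoset.IsGeometric Φ S (suc k) (RootPoset.underline Φ S k I) ×
         RootPoset.IsPositive Φ S (suc k) (RootPoset.underline Φ S k I) ×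
         (∀ x → RootPoset.θ⁻¹ Φ S (suc k) (RootPoset.underline Φ S k I) x →
                RootPoset.θ⁻¹ Φ S k I x)
lemma6 E Φ _ S k 1≤k I I-geometric = I̲-geometric , I̲-positive , θ⁻¹-I̲⊆θ⁻¹-I
  where open Underline Φ S k 1≤k I I-geometric
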